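{- For all integers $m\ge 2$ and $n\ge 1$, $\chi_{la}(C_{2m}\vee O_{2n})=3$.
   Context: All graphs are simple. For a connected graph $G=(V,E)$, a local antimagic labeling is a bijection $f:E\to\{1,\dots,|E|\}$ such that, writing $f^+(u)=\sum_{e\ni u} f(e)$ (sum over edges incident to $u$), we have $f^+(x)\ne f^+(y)$ for every pair of adjacent vertices $x,y$. The color number $c(f)$ is the number of distinct values of $f^+$, and $\chi_{la}(G)$ is the minimum of $c(f)$ over all local antimagic labelings $f$ of $G$. $C_k$ is the cycle on $k$ vertices, $O_k$ the edgeless graph on $k$ vertices, and $G\vee H$ denotes the join (disjoint union plus all edges between $V(G)$ and $V(H)$). -}

module Defs where

open import Data.Nat using (ℕ; zero; suc; _+_; _*_; _∸_; _≟_)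
open import Data.Fin using (Fin; toℕ)
open import Data.Nat.ListAction using (sum)
open import Data.List using (List; []; _∷_; length; map; upTo; allFin; concatMap; deduplicate; _++_; lookup)
open import Data.Product using (_×_; _,_; proj₁; proj₂; ∃-syntax)
open import Data.Bool using (Bool; true; false; if_then_else_; _∨_)
open import Relation.Nullary.Decidable using (⌊_⌋)
open import Relation.Binary.PropositionalEquality using (_≡_; _≢_)
open import Function.Definitions using (Bijective)

-- A finite graph given by its number of vertices (vertices are 0,…,nv-1)
-- and its list of edges (each edge is an unordered pair {x,y}, written (x , y)).
record Graph : Set where
  constructor mkGraph
  field
    nv    : ℕ
    edges : List (ℕ × ℕ)

  ne : ℕ
  ne = length edges

  vertices : List ℕ
  vertices = upTo nv

  endpoints : Fin ne → ℕ × ℕ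
  endpoints e = lookup edges e

open Graph public

-- An edge labeling with labels 1..|E|: edge e receives label suc (toℕ (f e)),
-- where f : Fin |E| → Fin |E| is a bijection.
IsBijLabeling : (G : Graph) → (Fin (ne G) → Fin (ne G)) → Set
IsBijLabeling G f = Bijective _≡_ _≡_ f

label : (G : Graph) → (Fin (ne G) → Fin (ne G)) → Fin (ne G) → ℕ
label G f e = suc (toℕ (f e))

incident : (G : Graph) → Fin (ne G) → ℕ → Bool
incident G e u = ⌊ proj₁ (endpoints G e) ≟ u ⌋ ∨ ⌊ proj₂ (endpoints G e) ≟ u ⌋

vsum : (G : Graph) → (Fin (ne G) → Fin (ne G)) → ℕ → ℕ
vsum G f u = sum (map (λ e → if incident G e u then label G f e else 0) (allFin (ne G)))

IsLocalAntimagic : (G : Graph) → (Fin (ne G) → Fin (ne G)) → Set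
IsLocalAntimagic G f = IsBijLabeling G f × ((e : Fin (ne G)) →
  vsum G f (proj₁ (endpoints G e)) ≢ vsum G f (proj₂ (endpoints G e)))

colorNumber : (G : Graph) → (Fin (ne G) → Fin (ne G)) → ℕ
colorNumber G f = length (deduplicate _≟_ (map (vsum G f) (vertices G)))

ChiLaEq : Graph → ℕ → Set
ChiLaEq G k = (∃[ f ] (IsLocalAntimagic G f × colorNumber G f ≡ k))
            × (∀ f → IsLocalAntimagic G f → k Data.Nat.≤ colorNumber G f)

-- C_k ∨ O_l : vertices 0..k-1 form the cycle (i ~ i+1 mod k),
-- vertices k..k+l-1 are independent and adjacent to every cycle vertex.
cycleEdges : ℕ → List (ℕ × ℕ)
cycleEdges zero = []
cycleEdges (suc k) = map (λ i → (i , suc i)) (upTo k) ++ ((k , 0) ∷ [])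

joinEdges : ℕ → ℕ → List (ℕ × ℕ)
joinEdges k l = concatMap (λ i → map (λ j → (i , k + j)) (upTo l)) (upTo k)

cycleJoinEmpty : ℕ → ℕ → Graph
cycleJoinEmpty k l = mkGraph (k + l) (cycleEdges k ++ joinEdges k l)

module Submission where

-- Lower bound: the cycle vertices 0, 1 and the independent vertex 2m form a
-- triangle, whose vertices need pairwise distinct vertex sums.
-- Upper bound: an explicit labeling.  The labels 1 … E are split into 2n + 1
-- blocks of 2m consecutive values; the cycle receives the middle block and the
-- 2m × 2n array of join edges is filled from symmetric pairs of blocks, so that
-- every independent vertex gets m (E + 1), every even cycle vertex
-- (n + 1)(E + 1) − δ and every odd one (n + 1)(E + 1) + δ, with 0 < δ < E + 1.
-- An explicit decoder shows that the labeling is injective, hence bijective.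

open import Defs
open import Data.Nat using (ℕ; zero; suc; pred; _+_; _*_; _∸_; _≤_; _<_; z≤n; s≤s; s≤s⁻¹; _≟_; _<?_; NonZero)
open import Data.Nat.Properties
open import Data.Nat.DivMod using (_/_; _%_; m≡m%n+[m/n]*n; [m+kn]%n≡m%n; m<n⇒m%n≡m; m<n⇒m/n≡0; m*n%n≡0; m*n/n≡m; +-distrib-/-∣ˡ; m%n<n; m<n*o⇒m/o<n)
open import Data.Nat.Divisibility using (n∣m*n)
open import Data.Nat.Tactic.RingSolver using (solve-∀)
open import Data.Nat.ListAction using (sum)
open import Data.Fin using (Fin; toℕ; fromℕ<; punchOut)
import Data.Fin as Fin
import Data.Fin.Properties as FinP
open import Data.List using (List; []; _∷_; length; map; upTo; applyUpTo; tabulate; concat; _++_; lookup; deduplicate)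
open import Data.List.Properties using (map-tabulate; length-map; length-applyUpTo; length-++)
import Data.List.Relation.Unary.All as All
open All using (All; []; _∷_)
import Data.List.Relation.Unary.All.Properties as AllP
open import Data.List.Relation.Unary.Any using (here; there; index)
open import Data.List.Relation.Unary.Any.Properties using (lookup-index)
open import Data.List.Relation.Unary.AllPairs using (AllPairs; []; _∷_)
open import Data.List.Relation.Unary.Unique.DecPropositional.Properties _≟_ using (deduplicate-!)
open import Data.List.Membership.Propositional using (_∈_)
open import Data.List.Membership.Propositional.Properties
  using (∈-map⁺; ∈-map⁻; ∈-upTo⁺; ∈-upTo⁻; ∈-deduplicate⁺; ∈-++⁺ˡ; ∈-++⁺ʳ; ∈-++⁻; ∈-concat⁺′; ∈-concat⁻′; ∈-lookup)
open import Data.Product using (_×_; _,_; proj₁; proj₂; ∃)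
open import Data.Sum using (_⊎_; inj₁; inj₂)
open import Data.Bool using (Bool; true; false; if_then_else_; _∨_)
open import Data.Empty using (⊥; ⊥-elim)
open import Relation.Binary using (tri<; tri≈; tri>)
open import Relation.Binary.PropositionalEquality
open import Relation.Nullary.Decidable using (⌊_⌋; yes; no; dec-true; dec-false; isYes≗does)
open import Function using (_∘_)
open import Function.Definitions using (Injective; Bijective)

∑ : ℕ → (ℕ → ℕ) → ℕ
∑ zero    F = 0
∑ (suc n) F = F 0 + ∑ n (F ∘ suc)

syntax ∑ n (λ i → e) = ∑[ i < n ] e

∑-cong : ∀ n {F G : ℕ → ℕ} → (∀ i → i < n → F i ≡ G i) → ∑ n F ≡ ∑ n G
∑-cong zero    F≡G = refl
∑-cong (suc n) F≡G = cong₂ _+_ (F≡G 0 (s≤s z≤n)) (∑-cong n (λ i i<n → F≡G (suc i) (s≤s i<n)))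

∑-+ : ∀ n (F G : ℕ → ℕ) → ∑[ i < n ] (F i + G i) ≡ ∑ n F + ∑ n G
∑-+ zero    F G = refl
∑-+ (suc n) F G = trans (cong (F 0 + G 0 +_) (∑-+ n (F ∘ suc) (G ∘ suc)))
                        (+-+-interchange (F 0) (G 0) _ _)
  where
  +-+-interchange : ∀ a b c d → a + b + (c + d) ≡ a + c + (b + d)
  +-+-interchange = solve-∀

∑-*ˡ : ∀ n c (F : ℕ → ℕ) → ∑[ i < n ] (c * F i) ≡ c * ∑ n F
∑-*ˡ zero    c F = sym (*-zeroʳ c)
∑-*ˡ (suc n) c F = trans (cong (c * F 0 +_) (∑-*ˡ n c (F ∘ suc))) (sym (*-distribˡ-+ c (F 0) _))

∑-const : ∀ n c → ∑[ i < n ] c ≡ n * c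
∑-const zero    c = refl
∑-const (suc n) c = cong (c +_) (∑-const n c)

∑-zero : ∀ n {F : ℕ → ℕ} → (∀ i → i < n → F i ≡ 0) → ∑ n F ≡ 0
∑-zero n F≡0 = trans (∑-cong n F≡0) (trans (∑-const n 0) (*-zeroʳ n))

∑-last : ∀ n (F : ℕ → ℕ) → ∑ (suc n) F ≡ ∑ n F + F n
∑-last zero    F = +-comm (F 0) 0
∑-last (suc n) F = trans (cong (F 0 +_) (∑-last n (F ∘ suc))) (sym (+-assoc (F 0) _ _))

∑-pairs : ∀ n (F : ℕ → ℕ) → ∑ (2 * n) F ≡ ∑[ p < n ] (F (2 * p) + F (suc (2 * p)))
∑-pairs zero    F = refl
∑-pairs (suc n) F = begin
  ∑ (2 * suc n) F                                            ≡⟨ cong (λ x → ∑ x F) (2*suc n) ⟩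
  F 0 + (F 1 + ∑ (2 * n) (F ∘ suc ∘ suc))                    ≡⟨ sym (+-assoc (F 0) (F 1) _) ⟩
  F 0 + F 1 + ∑ (2 * n) (F ∘ suc ∘ suc)                      ≡⟨ cong (F 0 + F 1 +_) (∑-pairs n (F ∘ suc ∘ suc)) ⟩
  F 0 + F 1 + ∑[ p < n ] (F (2 + 2 * p) + F (3 + 2 * p))     ≡⟨ cong (F 0 + F 1 +_) (∑-cong n shift) ⟩
  F 0 + F 1 + ∑[ p < n ] (F (2 * suc p) + F (suc (2 * suc p))) ∎
  where
  open ≡-Reasoning
  2*suc : ∀ n → 2 * suc n ≡ 2 + 2 * n
  2*suc = solve-∀
  shift : ∀ p → p < n → F (2 + 2 * p) + F (3 + 2 * p) ≡ F (2 * suc p) + F (suc (2 * suc p))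
  shift p _ = cong (λ x → F x + F (suc x)) (sym (2*suc p))

∑-single : ∀ n (F : ℕ → ℕ) k → k < n → (∀ i → i < n → i ≢ k → F i ≡ 0) → ∑ n F ≡ F k
∑-single (suc n) F zero    _         others = trans (cong (F 0 +_) (∑-zero n (λ i i<n → others (suc i) (s≤s i<n) (λ ()))))
                                                   (+-identityʳ (F 0))
∑-single (suc n) F (suc k) (s≤s k<n) others = trans (cong (_+ ∑ n (F ∘ suc)) (others 0 (s≤s z≤n) (λ ())))
  (∑-single n (F ∘ suc) k k<n (λ i i<n i≢k → others (suc i) (s≤s i<n) (i≢k ∘ suc-injective)))

∑-reverse : ∀ n (F : ℕ → ℕ) → ∑[ t < n ] F (n ∸ 1 ∸ t) ≡ ∑ n F
∑-reverse zero    F = refl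
∑-reverse (suc n) F = begin
  F n + ∑[ t < n ] F (n ∸ suc t)  ≡⟨ cong (F n +_) (∑-cong n (λ t _ → cong F (sym (∸-+-assoc n 1 t)))) ⟩
  F n + ∑[ t < n ] F (n ∸ 1 ∸ t)  ≡⟨ cong (F n +_) (∑-reverse n F) ⟩
  F n + ∑ n F                     ≡⟨ +-comm (F n) _ ⟩
  ∑ n F + F n                     ≡⟨ sym (∑-last n F) ⟩
  ∑ (suc n) F                     ∎
  where open ≡-Reasoning

∑-id : ∀ n → 2 * ∑[ t < suc n ] t ≡ suc n * n
∑-id zero    = refl
∑-id (suc n) = begin
  2 * ∑[ t < suc (suc n) ] t           ≡⟨ cong (2 *_) (∑-last (suc n) (λ t → t)) ⟩
  2 * (∑[ t < suc n ] t + suc n)       ≡⟨ *-distribˡ-+ 2 (∑[ t < suc n ] t) (suc n) ⟩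
  2 * ∑[ t < suc n ] t + 2 * suc n     ≡⟨ cong (_+ 2 * suc n) (∑-id n) ⟩
  suc n * n + 2 * suc n                ≡⟨ step n ⟩
  suc (suc n) * suc n                  ∎
  where
  open ≡-Reasoning
  step : ∀ n → suc n * n + 2 * suc n ≡ suc (suc n) * suc n
  step = solve-∀

incidentTo : ℕ × ℕ → ℕ → Bool
incidentTo (x , y) u = ⌊ x ≟ u ⌋ ∨ ⌊ y ≟ u ⌋

edgeSum : List (ℕ × ℕ) → (ℕ → ℕ) → ℕ → ℕ → ℕ
edgeSum []       L k u = 0
edgeSum (x ∷ es) L k u = (if incidentTo x u then L k else 0) + edgeSum es L (suc k) u

private
  sum-tabulate-edgeSum : ∀ (L : ℕ → ℕ) u es k (φ : Fin (length es) → ℕ) →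
    (∀ e → φ e ≡ (if incidentTo (lookup es e) u then L (k + toℕ e) else 0)) →
    sum (tabulate φ) ≡ edgeSum es L k u
  sum-tabulate-edgeSum L u []       k φ φ≡ = refl
  sum-tabulate-edgeSum L u (x ∷ es) k φ φ≡ = cong₂ _+_
    (trans (φ≡ Fin.zero) (cong (λ i → if incidentTo x u then L i else 0) (+-identityʳ k)))
    (sum-tabulate-edgeSum L u es (suc k) (φ ∘ Fin.suc)
      (λ e → trans (φ≡ (Fin.suc e)) (cong (λ i → if incidentTo (lookup es e) u then L i else 0) (+-suc k (toℕ e)))))

vsum≡edgeSum : ∀ (G : Graph) (f : Fin (ne G) → Fin (ne G)) (L : ℕ → ℕ) →
  (∀ e → suc (toℕ (f e)) ≡ L (toℕ e)) → ∀ u → vsum G f u ≡ edgeSum (edges G) L 0 u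
vsum≡edgeSum G f L f≡L u =
  trans (cong sum (map-tabulate {n = ne G} (λ e → e) (λ e → if incident G e u then label G f e else 0)))
        (sum-tabulate-edgeSum L u (edges G) 0 _
          (λ e → cong (λ x → if incidentTo (lookup (edges G) e) u then x else 0) (f≡L e)))

edgeSum-++ : ∀ L u xs ys k → edgeSum (xs ++ ys) L k u ≡ edgeSum xs L k u + edgeSum ys L (k + length xs) u
edgeSum-++ L u []       ys k = cong (λ i → edgeSum ys L i u) (sym (+-identityʳ k))
edgeSum-++ L u (x ∷ xs) ys k = begin
  first + edgeSum (xs ++ ys) L (suc k) u                                   ≡⟨ cong (first +_) (edgeSum-++ L u xs ys (suc k)) ⟩
  first + (edgeSum xs L (suc k) u + edgeSum ys L (suc k + length xs) u)    ≡⟨ sym (+-assoc first _ _) ⟩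
  first + edgeSum xs L (suc k) u + edgeSum ys L (suc k + length xs) u      ≡⟨ cong (λ i → first + edgeSum xs L (suc k) u + edgeSum ys L i u) (sym (+-suc k (length xs))) ⟩
  first + edgeSum xs L (suc k) u + edgeSum ys L (k + suc (length xs)) u    ∎
  where
  open ≡-Reasoning
  first = if incidentTo x u then L k else 0

edgeSum-map : ∀ L u (h : ℕ → ℕ × ℕ) n (g : ℕ → ℕ) k →
  edgeSum (map h (applyUpTo g n)) L k u ≡ ∑[ i < n ] (if incidentTo (h (g i)) u then L (k + i) else 0)
edgeSum-map L u h zero    g k = refl
edgeSum-map L u h (suc n) g k = cong₂ _+_
  (cong (λ i → if incidentTo (h (g 0)) u then L i else 0) (sym (+-identityʳ k)))
  (trans (edgeSum-map L u h n (g ∘ suc) (suc k))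
         (∑-cong n (λ i _ → cong (λ j → if incidentTo (h (g (suc i))) u then L j else 0) (sym (+-suc k i)))))

edgeSum-concat : ∀ L u (block : ℕ → List (ℕ × ℕ)) N → (∀ v → length (block v) ≡ N) → ∀ B (g : ℕ → ℕ) k →
  edgeSum (concat (map block (applyUpTo g B))) L k u ≡ ∑[ v < B ] edgeSum (block (g v)) L (k + v * N) u
edgeSum-concat L u block N len zero    g k = refl
edgeSum-concat L u block N len (suc B) g k = begin
  edgeSum (block (g 0) ++ rest) L k u                                     ≡⟨ edgeSum-++ L u (block (g 0)) rest k ⟩
  edgeSum (block (g 0)) L k u + edgeSum rest L (k + length (block (g 0))) u ≡⟨ cong₂ _+_ (cong (λ i → edgeSum (block (g 0)) L i u) (sym (+-identityʳ k)))
                                                                                       (cong (λ i → edgeSum rest L (k + i) u) (len (g 0))) ⟩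
  edgeSum (block (g 0)) L (k + 0) u + edgeSum rest L (k + N) u           ≡⟨ cong (edgeSum (block (g 0)) L (k + 0) u +_) (edgeSum-concat L u block N len B (g ∘ suc) (k + N)) ⟩
  edgeSum (block (g 0)) L (k + 0) u + ∑[ v < B ] edgeSum (block (g (suc v))) L (k + N + v * N) u
                                                                         ≡⟨ cong (edgeSum (block (g 0)) L (k + 0) u +_)
                                                                              (∑-cong B (λ v _ → cong (λ i → edgeSum (block (g (suc v))) L i u) (+-assoc k N (v * N)))) ⟩
  edgeSum (block (g 0)) L (k + 0) u + ∑[ v < B ] edgeSum (block (g (suc v))) L (k + suc v * N) u ∎
  where
  open ≡-Reasoning
  rest = concat (map block (applyUpTo (g ∘ suc) B))

length-concat-blocks : ∀ (block : ℕ → List (ℕ × ℕ)) N → (∀ v → length (block v) ≡ N) → ∀ B (g : ℕ → ℕ) →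
  length (concat (map block (applyUpTo g B))) ≡ B * N
length-concat-blocks block N len zero    g = refl
length-concat-blocks block N len (suc B) g =
  trans (length-++ (block (g 0))) (cong₂ _+_ (len (g 0)) (length-concat-blocks block N len B (g ∘ suc)))

-- Positions 0 … M' are the cycle edges
-- (edge i joins i and i + 1, edge M' joins M' and 0), and the edge joining
-- cycle vertex v to independent vertex M + j sits at position M + v N + j.

prev : ℕ → ℕ → ℕ
prev M' zero    = M'
prev M' (suc u) = u

private
  ⌊⌋-true : ∀ {a b : ℕ} → a ≡ b → ⌊ a ≟ b ⌋ ≡ true
  ⌊⌋-true {a} {b} a≡b = trans (isYes≗does (a ≟ b)) (dec-true (a ≟ b) a≡b)

  ⌊⌋-false : ∀ {a b : ℕ} → a ≢ b → ⌊ a ≟ b ⌋ ≡ false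
  ⌊⌋-false {a} {b} a≢b = trans (isYes≗does (a ≟ b)) (dec-false (a ≟ b) a≢b)

  ∑-hit : ∀ n (g L : ℕ → ℕ) u k → k < n → g k ≡ u → (∀ i → g i ≡ u → i ≡ k) →
    ∑[ i < n ] (if ⌊ g i ≟ u ⌋ then L i else 0) ≡ L k
  ∑-hit n g L u k k<n gk≡u only-k = trans
    (∑-single n _ k k<n (λ i _ i≢k → cong (λ b → if b then L i else 0) (⌊⌋-false (i≢k ∘ only-k i))))
    (cong (λ b → if b then L k else 0) (⌊⌋-true gk≡u))

  ∑-miss : ∀ n (g L : ℕ → ℕ) u → (∀ i → i < n → g i ≢ u) → ∑[ i < n ] (if ⌊ g i ≟ u ⌋ then L i else 0) ≡ 0
  ∑-miss n g L u miss = ∑-zero n (λ i i<n → cong (λ b → if b then L i else 0) (⌊⌋-false (miss i i<n)))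

  if-∨ : ∀ a b x → (a ≡ true → b ≡ true → ⊥) → (if a ∨ b then x else 0) ≡ (if a then x else 0) + (if b then x else 0)
  if-∨ true  true  x both = ⊥-elim (both refl refl)
  if-∨ true  false x _    = sym (+-identityʳ x)
  if-∨ false b     x _    = refl

  length-path : ∀ M' → length (map (λ i → (i , suc i)) (upTo M')) ≡ M'
  length-path M' = trans (length-map _ (upTo M')) (length-applyUpTo (λ i → i) M')

length-cycleEdges : ∀ M' → length (cycleEdges (suc M')) ≡ suc M'
length-cycleEdges M' = trans (length-++ (map (λ i → (i , suc i)) (upTo M'))) (trans (cong (_+ 1) (length-path M')) (+-comm M' 1))

length-joinEdges : ∀ M N → length (joinEdges M N) ≡ M * N
length-joinEdges M N = length-concat-blocks (λ v → map (λ j → (v , M + j)) (upTo N)) N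
  (λ v → trans (length-map _ (upTo N)) (length-applyUpTo (λ i → i) N)) M (λ i → i)

cycle-edgeSum-split : ∀ M' L u → edgeSum (cycleEdges (suc M')) L 0 u ≡
  ∑[ i < M' ] (if ⌊ i ≟ u ⌋ then L i else 0) + ∑[ i < M' ] (if ⌊ suc i ≟ u ⌋ then L i else 0)
  + (if ⌊ M' ≟ u ⌋ ∨ ⌊ 0 ≟ u ⌋ then L M' else 0)
cycle-edgeSum-split M' L u = begin
  edgeSum (path ++ (M' , 0) ∷ []) L 0 u                                      ≡⟨ edgeSum-++ L u path _ 0 ⟩
  edgeSum path L 0 u + edgeSum ((M' , 0) ∷ []) L (length path) u             ≡⟨ cong₂ _+_ (edgeSum-map L u (λ i → (i , suc i)) M' (λ i → i) 0)
                                                                                          (cong (λ i → edgeSum ((M' , 0) ∷ []) L i u) (length-path M')) ⟩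
  ∑[ i < M' ] (if ⌊ i ≟ u ⌋ ∨ ⌊ suc i ≟ u ⌋ then L i else 0) + (closing + 0) ≡⟨ cong₂ _+_ (trans (∑-cong M' (λ i _ → if-∨ ⌊ i ≟ u ⌋ _ (L i) (not-both i)))
                                                                                                   (∑-+ M' _ _))
                                                                                          (+-identityʳ closing) ⟩
  ∑[ i < M' ] (if ⌊ i ≟ u ⌋ then L i else 0) + ∑[ i < M' ] (if ⌊ suc i ≟ u ⌋ then L i else 0) + closing ∎
  where
  open ≡-Reasoning
  path = map (λ i → (i , suc i)) (upTo M')
  closing = if ⌊ M' ≟ u ⌋ ∨ ⌊ 0 ≟ u ⌋ then L M' else 0
  not-both : ∀ i → ⌊ i ≟ u ⌋ ≡ true → ⌊ suc i ≟ u ⌋ ≡ true → ⊥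
  not-both i i≡u si≡u with i ≟ u | suc i ≟ u
  not-both i refl refl | yes refl | yes si≡i = 1+n≢n si≡i

cycle-edgeSum : ∀ M' L u → 1 ≤ M' → u ≤ M' → edgeSum (cycleEdges (suc M')) L 0 u ≡ L u + L (prev M' u)
cycle-edgeSum (suc M'') L zero _ _ = begin
  edgeSum (cycleEdges (suc M')) L 0 0                                        ≡⟨ cycle-edgeSum-split M' L 0 ⟩
  ∑[ i < M' ] (if ⌊ i ≟ 0 ⌋ then L i else 0) + ∑[ i < M' ] (if ⌊ suc i ≟ 0 ⌋ then L i else 0) + L M'
                                                                             ≡⟨ cong (λ x → x + L M') (cong₂ _+_ (∑-hit M' (λ i → i) L 0 0 (s≤s z≤n) refl (λ i i≡0 → i≡0))
                                                                                                                    (∑-miss M' suc L 0 (λ i _ ())) ) ⟩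
  L 0 + 0 + L M'                                                             ≡⟨ cong (_+ L M') (+-identityʳ (L 0)) ⟩
  L 0 + L M'                                                                 ∎
  where
  open ≡-Reasoning
  M' = suc M''
cycle-edgeSum M' L (suc u) _ u<M' with m≤n⇒m<n∨m≡n u<M'
... | inj₁ 1+u<M' = begin
  edgeSum (cycleEdges (suc M')) L 0 (suc u)                                  ≡⟨ cycle-edgeSum-split M' L (suc u) ⟩
  ∑[ i < M' ] (if ⌊ i ≟ suc u ⌋ then L i else 0) + ∑[ i < M' ] (if ⌊ suc i ≟ suc u ⌋ then L i else 0)
    + (if ⌊ M' ≟ suc u ⌋ ∨ false then L M' else 0)                           ≡⟨ cong₂ _+_ (cong₂ _+_ (∑-hit M' (λ i → i) L (suc u) (suc u) 1+u<M' refl (λ i i≡ → i≡))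
                                                                                                      (∑-hit M' suc L (suc u) u u<M' refl (λ i → suc-injective)))
                                                                                          (cong (λ b → if b ∨ false then L M' else 0) (⌊⌋-false (>⇒≢ 1+u<M'))) ⟩
  L (suc u) + L u + 0                                                        ≡⟨ +-identityʳ _ ⟩
  L (suc u) + L u                                                            ∎
  where open ≡-Reasoning
... | inj₂ refl = begin
  edgeSum (cycleEdges (suc (suc u))) L 0 (suc u)                             ≡⟨ cycle-edgeSum-split (suc u) L (suc u) ⟩
  ∑[ i < suc u ] (if ⌊ i ≟ suc u ⌋ then L i else 0) + ∑[ i < suc u ] (if ⌊ suc i ≟ suc u ⌋ then L i else 0)
    + (if ⌊ suc u ≟ suc u ⌋ ∨ false then L (suc u) else 0)                   ≡⟨ cong₂ _+_ (cong₂ _+_ (∑-miss (suc u) (λ i → i) L (suc u) (λ i → <⇒≢))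
                                                                                                      (∑-hit (suc u) suc L (suc u) u ≤-refl refl (λ i → suc-injective)))
                                                                                          (cong (λ b → if b ∨ false then L (suc u) else 0) (⌊⌋-true refl)) ⟩
  0 + L u + L (suc u)                                                        ≡⟨ +-comm (L u) (L (suc u)) ⟩
  L (suc u) + L u                                                            ∎
  where open ≡-Reasoning

cycle-edgeSum-outside : ∀ M' L u → M' < u → edgeSum (cycleEdges (suc M')) L 0 u ≡ 0
cycle-edgeSum-outside M' L u M'<u = begin
  edgeSum (cycleEdges (suc M')) L 0 u                                        ≡⟨ cycle-edgeSum-split M' L u ⟩
  ∑[ i < M' ] (if ⌊ i ≟ u ⌋ then L i else 0) + ∑[ i < M' ] (if ⌊ suc i ≟ u ⌋ then L i else 0)
    + (if ⌊ M' ≟ u ⌋ ∨ ⌊ 0 ≟ u ⌋ then L M' else 0)                           ≡⟨ cong₂ _+_ (cong₂ _+_ (∑-miss M' (λ i → i) L u (λ i i<M' → <⇒≢ (<-trans i<M' M'<u)))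
                                                                                                      (∑-miss M' suc L u (λ i i<M' → <⇒≢ (<-≤-trans (s≤s i<M') M'<u))))
                                                                                          (cong₂ (λ a b → if a ∨ b then L M' else 0) (⌊⌋-false (<⇒≢ M'<u))
                                                                                                 (⌊⌋-false (<⇒≢ (≤-<-trans z≤n M'<u)))) ⟩
  0                                                                          ∎
  where open ≡-Reasoning

join-edgeSum : ∀ L u M N k → edgeSum (joinEdges M N) L k u ≡
  ∑[ v < M ] ∑[ j < N ] (if incidentTo (v , M + j) u then L (k + v * N + j) else 0)
join-edgeSum L u M N k = trans
  (edgeSum-concat L u (λ v → map (λ j → (v , M + j)) (upTo N)) N
    (λ v → trans (length-map _ (upTo N)) (length-applyUpTo (λ i → i) N)) M (λ i → i) k)
  (∑-cong M (λ v _ → edgeSum-map L u (λ j → (v , M + j)) N (λ i → i) (k + v * N)))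

join-edgeSum-cycleVertex : ∀ L u M N k → u < M → edgeSum (joinEdges M N) L k u ≡ ∑[ j < N ] L (k + u * N + j)
join-edgeSum-cycleVertex L u M N k u<M = begin
  edgeSum (joinEdges M N) L k u                                                   ≡⟨ join-edgeSum L u M N k ⟩
  ∑[ v < M ] ∑[ j < N ] (if incidentTo (v , M + j) u then L (k + v * N + j) else 0) ≡⟨ ∑-single M _ u u<M other-rows ⟩
  ∑[ j < N ] (if ⌊ u ≟ u ⌋ ∨ ⌊ M + j ≟ u ⌋ then L (k + u * N + j) else 0)       ≡⟨ ∑-cong N (λ j _ → cong (λ a → if a ∨ ⌊ M + j ≟ u ⌋ then L (k + u * N + j) else 0)
                                                                                                           (⌊⌋-true refl)) ⟩
  ∑[ j < N ] L (k + u * N + j)                                                    ∎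
  where
  open ≡-Reasoning
  M+j≢u : ∀ j → M + j ≢ u
  M+j≢u j = >⇒≢ (<-≤-trans u<M (m≤m+n M j))
  other-rows : ∀ v → v < M → v ≢ u → ∑[ j < N ] (if incidentTo (v , M + j) u then L (k + v * N + j) else 0) ≡ 0
  other-rows v _ v≢u = ∑-zero N (λ j _ → cong₂ (λ a b → if a ∨ b then L (k + v * N + j) else 0)
                                         (⌊⌋-false v≢u) (⌊⌋-false (M+j≢u j)))

join-edgeSum-independentVertex : ∀ L M N k j → j < N → edgeSum (joinEdges M N) L k (M + j) ≡ ∑[ v < M ] L (k + v * N + j)
join-edgeSum-independentVertex L M N k j j<N = trans (join-edgeSum L (M + j) M N k)
  (∑-cong M (λ v v<M → trans
    (∑-cong N (λ j′ _ → cong (λ a → if a ∨ ⌊ M + j′ ≟ M + j ⌋ then L (k + v * N + j′) else 0)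
                            (⌊⌋-false (<⇒≢ (<-≤-trans v<M (m≤m+n M j))))))
    (∑-hit N (M +_) (λ j′ → L (k + v * N + j′)) (M + j) j j<N refl (λ j′ → +-cancelˡ-≡ M j′ j))))

module JoinVertexSums (M' N : ℕ)
  (f : Fin (ne (cycleJoinEmpty (suc M') N)) → Fin (ne (cycleJoinEmpty (suc M') N)))
  (L : ℕ → ℕ) (f≡L : ∀ e → suc (toℕ (f e)) ≡ L (toℕ e)) where

  private
    M = suc M'
    G = cycleJoinEmpty M N

    cycle+join : ∀ u → vsum G f u ≡ edgeSum (cycleEdges M) L 0 u + edgeSum (joinEdges M N) L M u
    cycle+join u = trans (vsum≡edgeSum G f L f≡L u)
      (trans (edgeSum-++ L u (cycleEdges M) (joinEdges M N) 0)
             (cong (λ k → edgeSum (cycleEdges M) L 0 u + edgeSum (joinEdges M N) L k u) (length-cycleEdges M')))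

  vsum-cycleVertex : 1 ≤ M' → ∀ w → w < M → vsum G f w ≡ L w + L (prev M' w) + ∑[ j < N ] L (M + w * N + j)
  vsum-cycleVertex 1≤M' w w<M = trans (cycle+join w)
    (cong₂ _+_ (cycle-edgeSum M' L w 1≤M' (s≤s⁻¹ w<M)) (join-edgeSum-cycleVertex L w M N M w<M))

  vsum-independentVertex : ∀ j → j < N → vsum G f (M + j) ≡ ∑[ v < M ] L (M + v * N + j)
  vsum-independentVertex j j<N = trans (cycle+join (M + j))
    (cong₂ _+_ (cycle-edgeSum-outside M' L (M + j) (s≤s (m≤m+n M' j))) (join-edgeSum-independentVertex L M N M j j<N))

private
  remove : ∀ {x : ℕ} (S : List ℕ) → x ∈ S → List ℕ
  remove (_ ∷ S) (here _)  = S
  remove (y ∷ S) (there p) = y ∷ remove S p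

  length-remove : ∀ {x : ℕ} (S : List ℕ) (p : x ∈ S) → suc (length (remove S p)) ≡ length S
  length-remove (_ ∷ S) (here _)  = refl
  length-remove (y ∷ S) (there p) = cong suc (length-remove S p)

  ∈-remove : ∀ {x y : ℕ} (S : List ℕ) (p : x ∈ S) → y ∈ S → y ≢ x → y ∈ remove S p
  ∈-remove (_ ∷ S) (here refl) (here refl) y≢x = ⊥-elim (y≢x refl)
  ∈-remove (_ ∷ S) (here _)    (there q)   _   = q
  ∈-remove (_ ∷ S) (there p)   (here y≡)   _   = here y≡
  ∈-remove (_ ∷ S) (there p)   (there q)   y≢x = there (∈-remove S p q y≢x)

distinct-length≤ : ∀ (xs S : List ℕ) → AllPairs _≢_ xs → All (_∈ S) xs → length xs ≤ length S
distinct-length≤ []       S _             _           = z≤n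
distinct-length≤ (x ∷ xs) S (x≢xs ∷ uniq) (x∈S ∷ xs⊆S) = subst (suc (length xs) ≤_) (length-remove S x∈S)
  (s≤s (distinct-length≤ xs (remove S x∈S) uniq
         (All.zipWith (λ (y∈S , x≢y) → ∈-remove S x∈S y∈S (x≢y ∘ sym)) (xs⊆S , x≢xs))))

distinctValues≤3 : ∀ {a b c : ℕ} (xs : List ℕ) → All (_∈ a ∷ b ∷ c ∷ []) xs → length (deduplicate _≟_ xs) ≤ 3
distinctValues≤3 xs xs⊆abc = distinct-length≤ (deduplicate _≟_ xs) _ (deduplicate-! xs) (AllP.deduplicate⁺ _≟_ xs⊆abc)

distinctValues≥3 : ∀ {a b c : ℕ} (xs : List ℕ) → a ∈ xs → b ∈ xs → c ∈ xs → a ≢ b → a ≢ c → b ≢ c →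
  3 ≤ length (deduplicate _≟_ xs)
distinctValues≥3 xs a∈ b∈ c∈ a≢b a≢c b≢c = distinct-length≤ (_ ∷ _ ∷ _ ∷ []) (deduplicate _≟_ xs)
  ((a≢b ∷ a≢c ∷ []) ∷ (b≢c ∷ []) ∷ [] ∷ [])
  (∈-deduplicate⁺ _≟_ a∈ ∷ ∈-deduplicate⁺ _≟_ b∈ ∷ ∈-deduplicate⁺ _≟_ c∈ ∷ [])

triangle⇒≥3colors : ∀ (G : Graph) f → IsLocalAntimagic G f → ∀ {a b c} →
  (a , b) ∈ edges G → (a , c) ∈ edges G → (b , c) ∈ edges G → a < nv G → b < nv G → c < nv G →
  3 ≤ colorNumber G f
triangle⇒≥3colors G f (_ , antimagic) ab ac bc a<nv b<nv c<nv =
  distinctValues≥3 (map (vsum G f) (vertices G)) (occurs a<nv) (occurs b<nv) (occurs c<nv)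
    (separated ab) (separated ac) (separated bc)
  where
  occurs : ∀ {u} → u < nv G → vsum G f u ∈ map (vsum G f) (vertices G)
  occurs u<nv = ∈-map⁺ (vsum G f) (∈-upTo⁺ u<nv)
  separated : ∀ {x y} → (x , y) ∈ edges G → vsum G f x ≢ vsum G f y
  separated xy eq = antimagic (index xy) (subst (λ e → vsum G f (proj₁ e) ≡ vsum G f (proj₂ e)) (lookup-index xy) eq)

injective⇒onto : ∀ {q} (g : Fin q → Fin q) → Injective _≡_ _≡_ g → ∀ y → ∃ λ x → g x ≡ y
injective⇒onto {suc q} g g-inj y with FinP.any? (λ x → g x FinP.≟ y)
... | yes found = found
... | no ∄x = ⊥-elim (<-irrefl refl (FinP.injective⇒≤ {f = squeeze} squeeze-injective))
  where
  -- g misses y, so it factors injectively through Fin q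
  missed : ∀ x → y ≢ g x
  missed x y≡gx = ∄x (x , sym y≡gx)
  squeeze : Fin (suc q) → Fin q
  squeeze x = punchOut (missed x)
  squeeze-injective : Injective _≡_ _≡_ squeeze
  squeeze-injective {x} {x′} = g-inj ∘ FinP.punchOut-injective (missed x) (missed x′)

injective⇒bijective : ∀ {q} (g : Fin q → Fin q) → Injective _≡_ _≡_ g → Bijective _≡_ _≡_ g
injective⇒bijective g g-inj = g-inj , λ y → let (x , gx≡y) = injective⇒onto g g-inj y in
  x , λ z≡x → trans (cong g z≡x) gx≡y

data JoinEdge (M' N : ℕ) : ℕ × ℕ → Set where
  path    : ∀ i → suc i < suc M' → JoinEdge M' N (i , suc i)
  closing : JoinEdge M' N (M' , 0)
  spoke   : ∀ v j → v < suc M' → j < N → JoinEdge M' N (v , suc M' + j)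

classifyEdge : ∀ M' N {x} → x ∈ edges (cycleJoinEmpty (suc M') N) → JoinEdge M' N x
classifyEdge M' N x∈ with ∈-++⁻ (cycleEdges (suc M')) x∈
... | inj₁ x∈cycle with ∈-++⁻ (map (λ i → (i , suc i)) (upTo M')) x∈cycle
...   | inj₁ x∈path with ∈-map⁻ (λ i → (i , suc i)) x∈path
...     | i , i∈ , refl = path i (s≤s (∈-upTo⁻ i∈))
classifyEdge M' N x∈ | inj₁ x∈cycle | inj₂ (here refl) = closing
classifyEdge M' N x∈ | inj₂ x∈join with ∈-concat⁻′ (map (λ v → map (λ j → (v , suc M' + j)) (upTo N)) (upTo (suc M'))) x∈join
... | row , x∈row , row∈ with ∈-map⁻ (λ v → map (λ j → (v , suc M' + j)) (upTo N)) row∈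
...   | v , v∈ , refl with ∈-map⁻ (λ j → (v , suc M' + j)) x∈row
...     | j , j∈ , refl = spoke v j (∈-upTo⁻ v∈) (∈-upTo⁻ j∈)

spoke∈ : ∀ M N {v j} → v < M → j < N → (v , M + j) ∈ joinEdges M N
spoke∈ M N v<M j<N = ∈-concat⁺′ (∈-map⁺ (λ j → (_ , M + j)) (∈-upTo⁺ j<N)) (∈-map⁺ (λ v → map (λ j → (v , M + j)) (upTo N)) (∈-upTo⁺ v<M))

join-colors≥3 : ∀ M' N → 1 ≤ M' → 1 ≤ N → ∀ f → IsLocalAntimagic (cycleJoinEmpty (suc M') N) f →
  3 ≤ colorNumber (cycleJoinEmpty (suc M') N) f
join-colors≥3 M' N 1≤M' 1≤N f antimagic = triangle⇒≥3colors (cycleJoinEmpty (suc M') N) f antimagic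
  (∈-++⁺ˡ (∈-++⁺ˡ (∈-map⁺ (λ i → (i , suc i)) (∈-upTo⁺ 1≤M'))))
  (∈-++⁺ʳ (cycleEdges (suc M')) (spoke∈ (suc M') N (s≤s z≤n) 1≤N))
  (∈-++⁺ʳ (cycleEdges (suc M')) (spoke∈ (suc M') N (s≤s 1≤M') 1≤N))
  (≤-trans (s≤s z≤n) (m≤m+n (suc M') N))
  (≤-trans (s≤s 1≤M') (m≤m+n (suc M') N))
  (+-monoʳ-< (suc M') 1≤N)

divMod-unique : ∀ q r d .{{_ : NonZero d}} → r < d → (q * d + r) / d ≡ q × (q * d + r) % d ≡ r
divMod-unique q r d r<d = quotient , remainder
  where
  open ≡-Reasoning
  quotient : (q * d + r) / d ≡ q
  quotient = begin
    (q * d + r) / d      ≡⟨ +-distrib-/-∣ˡ r (n∣m*n q) ⟩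
    q * d / d + r / d    ≡⟨ cong₂ _+_ (m*n/n≡m q d) (m<n⇒m/n≡0 r<d) ⟩
    q + 0                ≡⟨ +-identityʳ q ⟩
    q                    ∎
  remainder : (q * d + r) % d ≡ r
  remainder = begin
    (q * d + r) % d      ≡⟨ cong (_% d) (+-comm (q * d) r) ⟩
    (r + q * d) % d      ≡⟨ [m+kn]%n≡m%n r q d ⟩
    r % d                ≡⟨ m<n⇒m%n≡m r<d ⟩
    r                    ∎

odd<double : ∀ {p n} → p < n → suc (2 * p) < 2 * n
odd<double {p} {n} p<n = ≤-trans (≤-reflexive (sym (double-suc p))) (*-monoʳ-≤ 2 p<n)
  where
  double-suc : ∀ p → 2 * suc p ≡ suc (suc (2 * p))
  double-suc = solve-∀

even<double : ∀ {p n} → p < n → 2 * p < 2 * n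
even<double p<n = ≤-trans (n≤1+n _) (odd<double p<n)

not-multiple : ∀ q c a d .{{_ : NonZero d}} → 0 < a → a < d → q * d + a ≢ c * d
not-multiple q c a d 0<a a<d eq = <⇒≢ 0<a (begin
  0                  ≡⟨ sym (m*n%n≡0 c d) ⟩
  c * d % d          ≡⟨ cong (_% d) (sym eq) ⟩
  (q * d + a) % d    ≡⟨ proj₂ (divMod-unique q a d a<d) ⟩
  a                  ∎)
  where open ≡-Reasoning

divMod-recompose : ∀ x d .{{_ : NonZero d}} → x / d * d + x % d ≡ x
divMod-recompose x d = trans (+-comm (x / d * d) (x % d)) (sym (m≡m%n+[m/n]*n x d))

half< : ∀ {x a} → x < 2 * a → x / 2 < a
half< {x} {a} x<2a = m<n*o⇒m/o<n (subst (x <_) (*-comm 2 a) x<2a)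

-- The labeling of C_M ∨ O_N for M = 2m, N = 2n, m = k + 2, n = l + 1.
--
-- The labels 1 … E, E = M (N + 1), are cut into 2n + 1 blocks of M
-- consecutive values.  The middle block n labels the cycle in order.  The
-- join edges form an M × N array (rows = cycle vertices v = 2t + b,
-- columns = independent vertices M + j, j = 2p + c); the four entries of
-- row pair t and column pair p are taken from the blocks lo p = n − 1 − p
-- and hi p = n + 1 + p, so that every column sums to m (E + 1), the even
-- rows to a common value and the odd rows to another one.  Column pair 0
-- is arranged specially so that these row values compensate the cycle labels.
module Construction (k l : ℕ) where

  m n M N E : ℕ
  m = suc (suc k)
  n = suc l
  M = 2 * m
  N = 2 * n
  E = M + M * N

  -- the two reflections t ↦ m − 1 − t and t ↦ −t (mod m) of {0, …, m − 1}
  r σ : ℕ → ℕ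
  r t = suc k ∸ t
  σ zero    = 0
  σ (suc t) = r t

  -- the two blocks used by column pair p, symmetric around block n
  lo hi : ℕ → ℕ
  lo p = l ∸ p
  hi p = suc n + p

  -- the value 2u + b of block K (labels are counted from 0 here)
  blk : ℕ → ℕ → ℕ → ℕ
  blk K u b = K * M + (u * 2 + b)

  -- entry p c t b: the label of the edge between cycle vertex 2t + b and
  -- independent vertex M + 2p + c.
  entry : ℕ → ℕ → ℕ → ℕ → ℕ
  entry zero    zero    t zero    = blk (lo 0) (r t) 1
  entry zero    zero    t (suc _) = blk (hi 0) (r t) 0
  entry zero    (suc _) t zero    = blk (lo 0) (σ t) 0
  entry zero    (suc _) t (suc _) = blk (hi 0) (r t) 1
  entry (suc p) zero    t zero    = blk (hi (suc p)) (r t) 0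
  entry (suc p) zero    t (suc _) = blk (lo (suc p)) t 1
  entry (suc p) (suc _) t zero    = blk (lo (suc p)) t 0
  entry (suc p) (suc _) t (suc _) = blk (hi (suc p)) (r t) 1

  joinPos : ℕ → ℕ → ℕ
  joinPos v j = M + v * N + j

  joinLab : ℕ → ℕ → ℕ
  joinLab v j = entry (j / 2) (j % 2) (v / 2) (v % 2)

  lab : ℕ → ℕ
  lab i with i <? M
  ... | yes _ = n * M + i
  ... | no  _ = joinLab ((i ∸ M) / N) ((i ∸ M) % N)

  lab-cycle : ∀ i → i < M → lab i ≡ n * M + i
  lab-cycle i i<M with i <? M
  ... | yes _   = refl
  ... | no  i≮M = ⊥-elim (i≮M i<M)

  lab-join : ∀ v j → j < N → lab (joinPos v j) ≡ joinLab v j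
  lab-join v j j<N with joinPos v j <? M
  ... | yes pos<M = ⊥-elim (<-irrefl refl (<-≤-trans pos<M (≤-trans (m≤m+n M (v * N)) (m≤m+n (M + v * N) j))))
  ... | no  _     = cong₂ joinLab (proj₁ v,j) (proj₂ v,j)
    where
    offset : joinPos v j ∸ M ≡ v * N + j
    offset = trans (cong (_∸ M) (+-assoc M (v * N) j)) (m+n∸m≡n M (v * N + j))
    v,j : (joinPos v j ∸ M) / N ≡ v × (joinPos v j ∸ M) % N ≡ j
    v,j with divMod-unique v j N j<N
    ... | q , rem = trans (cong (_/ N) offset) q , trans (cong (_% N) offset) rem

  pos : ℕ → ℕ → ℕ → ℕ → ℕ
  pos p c t b = joinPos (t * 2 + b) (p * 2 + c)

  decodeLo decodeHi : ℕ → ℕ → ℕ → ℕ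
  decodeLo zero    u zero    = pos 0 1 (σ u) 0
  decodeLo zero    u (suc _) = pos 0 0 (r u) 0
  decodeLo (suc p) u zero    = pos (suc p) 1 u 0
  decodeLo (suc p) u (suc _) = pos (suc p) 0 u 1
  decodeHi zero    u zero    = pos 0 0 (r u) 1
  decodeHi zero    u (suc _) = pos 0 1 (r u) 1
  decodeHi (suc p) u zero    = pos (suc p) 0 (r u) 0
  decodeHi (suc p) u (suc _) = pos (suc p) 1 (r u) 1

  decodeBlock : ℕ → ℕ → ℕ
  decodeBlock K o with <-cmp K n
  ... | tri< _ _ _ = decodeLo (l ∸ K) (o / 2) (o % 2)
  ... | tri≈ _ _ _ = o
  ... | tri> _ _ _ = decodeHi (K ∸ suc n) (o / 2) (o % 2)

  decode : ℕ → ℕ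
  decode y = decodeBlock (y / M) (y % M)

  decodeBlock-lo : ∀ K o → K < n → decodeBlock K o ≡ decodeLo (l ∸ K) (o / 2) (o % 2)
  decodeBlock-lo K o K<n with <-cmp K n
  ... | tri< _ _ _   = refl
  ... | tri≈ K≮n _ _ = ⊥-elim (K≮n K<n)
  ... | tri> K≮n _ _ = ⊥-elim (K≮n K<n)

  decodeBlock-mid : ∀ o → decodeBlock n o ≡ o
  decodeBlock-mid o with <-cmp n n
  ... | tri< _ n≢n _ = ⊥-elim (n≢n refl)
  ... | tri≈ _ _ _   = refl
  ... | tri> _ n≢n _ = ⊥-elim (n≢n refl)

  decodeBlock-hi : ∀ K o → n < K → decodeBlock K o ≡ decodeHi (K ∸ suc n) (o / 2) (o % 2)
  decodeBlock-hi K o n<K with <-cmp K n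
  ... | tri< _ _ K≯n = ⊥-elim (K≯n n<K)
  ... | tri≈ _ _ K≯n = ⊥-elim (K≯n n<K)
  ... | tri> _ _ _   = refl

  offset<M : ∀ u b → u < m → b < 2 → u * 2 + b < M
  offset<M u b u<m b<2 = <-≤-trans (+-monoʳ-< (u * 2) b<2)
    (≤-trans (≤-reflexive (+-comm (u * 2) 2)) (≤-trans (*-monoˡ-≤ 2 u<m) (≤-reflexive (*-comm m 2))))

  decode-block : ∀ K o → o < M → decode (K * M + o) ≡ decodeBlock K o
  decode-block K o o<M = cong₂ decodeBlock (proj₁ (divMod-unique K o M o<M)) (proj₂ (divMod-unique K o M o<M))

  decode-lo : ∀ p u b → p ≤ l → u < m → b < 2 → decode (blk (lo p) u b) ≡ decodeLo p u b
  decode-lo p u b p≤l u<m b<2 = begin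
    decode (blk (lo p) u b)                                         ≡⟨ decode-block (lo p) _ (offset<M u b u<m b<2) ⟩
    decodeBlock (l ∸ p) (u * 2 + b)                                 ≡⟨ decodeBlock-lo (l ∸ p) _ (s≤s (m∸n≤m l p)) ⟩
    decodeLo (l ∸ (l ∸ p)) ((u * 2 + b) / 2) ((u * 2 + b) % 2)      ≡⟨ cong₂ (λ p′ (ub : ℕ × ℕ) → decodeLo p′ (proj₁ ub) (proj₂ ub))
                                                                          (m∸[m∸n]≡n p≤l) (cong₂ _,_ (proj₁ halves) (proj₂ halves)) ⟩
    decodeLo p u b                                                  ∎
    where
    open ≡-Reasoning
    halves = divMod-unique u b 2 b<2

  decode-hi : ∀ p u b → u < m → b < 2 → decode (blk (hi p) u b) ≡ decodeHi p u b
  decode-hi p u b u<m b<2 = begin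
    decode (blk (hi p) u b)                                         ≡⟨ decode-block (hi p) _ (offset<M u b u<m b<2) ⟩
    decodeBlock (suc n + p) (u * 2 + b)                             ≡⟨ decodeBlock-hi (suc n + p) _ (s≤s (m≤m+n n p)) ⟩
    decodeHi (suc n + p ∸ suc n) ((u * 2 + b) / 2) ((u * 2 + b) % 2) ≡⟨ cong₂ (λ p′ (ub : ℕ × ℕ) → decodeHi p′ (proj₁ ub) (proj₂ ub))
                                                                          (m+n∸m≡n (suc n) p) (cong₂ _,_ (proj₁ halves) (proj₂ halves)) ⟩
    decodeHi p u b                                                  ∎
    where
    open ≡-Reasoning
    halves = divMod-unique u b 2 b<2

  r<m : ∀ t → r t < m
  r<m t = s≤s (m∸n≤m (suc k) t)

  σ<m : ∀ t → σ t < m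
  σ<m zero    = s≤s z≤n
  σ<m (suc t) = r<m t

  r-involutive : ∀ t → t < m → r (r t) ≡ t
  r-involutive t (s≤s t≤1+k) = m∸[m∸n]≡n t≤1+k

  σ-involutive : ∀ t → t < m → σ (σ t) ≡ t
  σ-involutive zero    _                = refl
  σ-involutive (suc t) (s≤s (s≤s t≤k)) = begin
    σ (suc k ∸ t)       ≡⟨ cong σ (+-∸-assoc 1 t≤k) ⟩
    r (k ∸ t)           ≡⟨ +-∸-assoc 1 (m∸n≤m k t) ⟩
    suc (k ∸ (k ∸ t))   ≡⟨ cong suc (m∸[m∸n]≡n t≤k) ⟩
    suc t               ∎
    where open ≡-Reasoning

  decode-entry : ∀ p c t b → p < n → c < 2 → t < m → b < 2 → decode (entry p c t b) ≡ pos p c t b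
  decode-entry zero zero t zero _ _ t<m _ =
    trans (decode-lo 0 (r t) 1 z≤n (r<m t) (s≤s (s≤s z≤n))) (cong (λ x → pos 0 0 x 0) (r-involutive t t<m))
  decode-entry zero zero t (suc zero) _ _ t<m _ =
    trans (decode-hi 0 (r t) 0 (r<m t) (s≤s z≤n)) (cong (λ x → pos 0 0 x 1) (r-involutive t t<m))
  decode-entry zero (suc zero) t zero _ _ t<m _ =
    trans (decode-lo 0 (σ t) 0 z≤n (σ<m t) (s≤s z≤n)) (cong (λ x → pos 0 1 x 0) (σ-involutive t t<m))
  decode-entry zero (suc zero) t (suc zero) _ _ t<m _ =
    trans (decode-hi 0 (r t) 1 (r<m t) (s≤s (s≤s z≤n))) (cong (λ x → pos 0 1 x 1) (r-involutive t t<m))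
  decode-entry (suc p) zero t zero _ _ t<m _ =
    trans (decode-hi (suc p) (r t) 0 (r<m t) (s≤s z≤n)) (cong (λ x → pos (suc p) 0 x 0) (r-involutive t t<m))
  decode-entry (suc p) zero t (suc zero) (s≤s p<l) _ t<m _ =
    decode-lo (suc p) t 1 p<l t<m (s≤s (s≤s z≤n))
  decode-entry (suc p) (suc zero) t zero (s≤s p<l) _ t<m _ =
    decode-lo (suc p) t 0 p<l t<m (s≤s z≤n)
  decode-entry (suc p) (suc zero) t (suc zero) _ _ t<m _ =
    trans (decode-hi (suc p) (r t) 1 (r<m t) (s≤s (s≤s z≤n))) (cong (λ x → pos (suc p) 1 x 1) (r-involutive t t<m))
  decode-entry p (suc (suc _)) t b _ (s≤s (s≤s ())) _ _
  decode-entry p c t (suc (suc _)) _ _ _ (s≤s (s≤s ()))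

  data Position : ℕ → Set where
    cyclePos : ∀ i → i < M → Position i
    spokePos : ∀ v j → v < M → j < N → Position (joinPos v j)

  position : ∀ i → i < E → Position i
  position i i<E with i <? M
  ... | yes i<M = cyclePos i i<M
  ... | no  i≮M = subst Position i≡ (spokePos v j (m<n*o⇒m/o<n x<M*N) (m%n<n x N))
    where
    x = i ∸ M
    v = x / N
    j = x % N
    M+x≡i : M + x ≡ i
    M+x≡i = m+[n∸m]≡n (≮⇒≥ i≮M)
    x<M*N : x < M * N
    x<M*N = +-cancelˡ-< M x (M * N) (subst (_< E) (sym M+x≡i) i<E)
    i≡ : joinPos v j ≡ i
    i≡ = trans (+-assoc M (v * N) j) (trans (cong (M +_) (divMod-recompose x N)) M+x≡i)

  decode-lab : ∀ i → i < E → decode (lab i) ≡ i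
  decode-lab i i<E with position i i<E
  ... | cyclePos i i<M = begin
    decode (lab i)        ≡⟨ cong decode (lab-cycle i i<M) ⟩
    decode (n * M + i)    ≡⟨ decode-block n i i<M ⟩
    decodeBlock n i       ≡⟨ decodeBlock-mid i ⟩
    i                     ∎
    where open ≡-Reasoning
  ... | spokePos v j v<M j<N = begin
    decode (lab (joinPos v j))                             ≡⟨ cong decode (lab-join v j j<N) ⟩
    decode (entry (j / 2) (j % 2) (v / 2) (v % 2))         ≡⟨ decode-entry (j / 2) (j % 2) (v / 2) (v % 2) (half< j<N) (m%n<n j 2) (half< v<M) (m%n<n v 2) ⟩
    joinPos (v / 2 * 2 + v % 2) (j / 2 * 2 + j % 2)       ≡⟨ cong₂ joinPos (divMod-recompose v 2) (divMod-recompose j 2) ⟩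
    joinPos v j                                            ∎
    where open ≡-Reasoning

  block<E : ∀ K o → K ≤ N → o < M → K * M + o < E
  block<E K o K≤N o<M = begin-strict
    K * M + o       <⟨ +-monoʳ-< (K * M) o<M ⟩
    K * M + M       ≤⟨ +-monoˡ-≤ M (*-monoˡ-≤ M K≤N) ⟩
    N * M + M       ≡⟨ trans (+-comm (N * M) M) (cong (M +_) (*-comm N M)) ⟩
    E               ∎
    where open ≤-Reasoning

  lo≤N : ∀ p → lo p ≤ N
  lo≤N p = ≤-trans (m∸n≤m l p) (≤-trans (n≤1+n l) (m≤m+n n (n + 0)))

  hi≤N : ∀ p → p < n → hi p ≤ N
  hi≤N p (s≤s p≤l) = ≤-trans (+-monoʳ-≤ (suc n) p≤l) (≤-reflexive (top l))
    where
    top : ∀ l → suc (suc l) + l ≡ 2 * suc l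
    top = solve-∀

  entry<E : ∀ p c t b → p < n → t < m → entry p c t b < E
  entry<E zero    zero    t zero    p<n t<m = block<E _ _ (lo≤N 0) (offset<M (r t) 1 (r<m t) (s≤s (s≤s z≤n)))
  entry<E zero    zero    t (suc _) p<n t<m = block<E _ _ (hi≤N 0 p<n) (offset<M (r t) 0 (r<m t) (s≤s z≤n))
  entry<E zero    (suc _) t zero    p<n t<m = block<E _ _ (lo≤N 0) (offset<M (σ t) 0 (σ<m t) (s≤s z≤n))
  entry<E zero    (suc _) t (suc _) p<n t<m = block<E _ _ (hi≤N 0 p<n) (offset<M (r t) 1 (r<m t) (s≤s (s≤s z≤n)))
  entry<E (suc p) zero    t zero    p<n t<m = block<E _ _ (hi≤N (suc p) p<n) (offset<M (r t) 0 (r<m t) (s≤s z≤n))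
  entry<E (suc p) zero    t (suc _) p<n t<m = block<E _ _ (lo≤N (suc p)) (offset<M t 1 t<m (s≤s (s≤s z≤n)))
  entry<E (suc p) (suc _) t zero    p<n t<m = block<E _ _ (lo≤N (suc p)) (offset<M t 0 t<m (s≤s z≤n))
  entry<E (suc p) (suc _) t (suc _) p<n t<m = block<E _ _ (hi≤N (suc p) p<n) (offset<M (r t) 1 (r<m t) (s≤s (s≤s z≤n)))

  lab<E : ∀ i → i < E → lab i < E
  lab<E i i<E with position i i<E
  ... | cyclePos i i<M       = subst (_< E) (sym (lab-cycle i i<M)) (block<E n i (m≤m+n n (n + 0)) i<M)
  ... | spokePos v j v<M j<N = subst (_< E) (sym (lab-join v j j<N))
          (entry<E (j / 2) (j % 2) (v / 2) (v % 2) (half< j<N) (half< v<M))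

  G : Graph
  G = cycleJoinEmpty M N

  M' : ℕ
  M' = pred M

  edgeCount : ne G ≡ E
  edgeCount = trans (length-++ (cycleEdges M)) (cong₂ _+_ (length-cycleEdges M') (length-joinEdges M N))

  position<E : (e : Fin (ne G)) → toℕ e < E
  position<E e = subst (toℕ e <_) edgeCount (FinP.toℕ<n e)

  f : Fin (ne G) → Fin (ne G)
  f e = fromℕ< (subst (lab (toℕ e) <_) (sym edgeCount) (lab<E (toℕ e) (position<E e)))

  L : ℕ → ℕ
  L i = suc (lab i)

  f≡L : ∀ e → suc (toℕ (f e)) ≡ L (toℕ e)
  f≡L e = cong suc (FinP.toℕ-fromℕ< _)

  -- f is injective because decode recovers the position from the label
  f-injective : Injective _≡_ _≡_ f
  f-injective {x} {y} fx≡fy = FinP.toℕ-injective (begin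
    toℕ x                ≡⟨ sym (decode-lab (toℕ x) (position<E x)) ⟩
    decode (lab (toℕ x)) ≡⟨ cong (decode ∘ pred) (trans (sym (f≡L x)) (trans (cong (suc ∘ toℕ) fx≡fy) (f≡L y))) ⟩
    decode (lab (toℕ y)) ≡⟨ decode-lab (toℕ y) (position<E y) ⟩
    toℕ y                ∎)
    where open ≡-Reasoning

  V : ℕ → ℕ → ℕ → ℕ → ℕ
  V p c t b = suc (entry p c t b)

  joinLab-entry : ∀ {v j} t b p c → b < 2 → c < 2 → v ≡ t * 2 + b → j ≡ p * 2 + c → joinLab v j ≡ entry p c t b
  joinLab-entry t b p c b<2 c<2 refl refl =
    cong₂ (λ (pc tb : ℕ × ℕ) → entry (proj₁ pc) (proj₂ pc) (proj₁ tb) (proj₂ tb))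
      (cong₂ _,_ (proj₁ (divMod-unique p c 2 c<2)) (proj₂ (divMod-unique p c 2 c<2)))
      (cong₂ _,_ (proj₁ (divMod-unique t b 2 b<2)) (proj₂ (divMod-unique t b 2 b<2)))

  private
    double : ∀ p → 2 * p ≡ p * 2 + 0
    double = solve-∀
    double+1 : ∀ p → suc (2 * p) ≡ p * 2 + 1
    double+1 = solve-∀

  row-pairs : ∀ v t b → b < 2 → v ≡ t * 2 + b → ∑[ j < N ] L (joinPos v j) ≡ ∑[ p < n ] (V p 0 t b + V p 1 t b)
  row-pairs v t b b<2 v≡ = trans (∑-pairs n (L ∘ joinPos v)) (∑-cong n (λ p p<n → cong₂ _+_
    (cong suc (trans (lab-join v (2 * p) (even<double p<n)) (joinLab-entry t b p 0 b<2 (s≤s z≤n) v≡ (double p))))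
    (cong suc (trans (lab-join v (suc (2 * p)) (odd<double p<n)) (joinLab-entry t b p 1 b<2 (s≤s (s≤s z≤n)) v≡ (double+1 p))))))

  column-pairs : ∀ p c → p < n → c < 2 → ∑[ v < M ] L (joinPos v (p * 2 + c)) ≡ ∑[ t < m ] (V p c t 0 + V p c t 1)
  column-pairs p c p<n c<2 = trans (∑-pairs m (λ v → L (joinPos v (p * 2 + c)))) (∑-cong m (λ t _ → cong₂ _+_
    (cong suc (trans (lab-join (2 * t) (p * 2 + c) j<N) (joinLab-entry t 0 p c (s≤s z≤n) c<2 (double t) refl)))
    (cong suc (trans (lab-join (suc (2 * t)) (p * 2 + c) j<N) (joinLab-entry t 1 p c (s≤s (s≤s z≤n)) c<2 (double+1 t) refl)))))
    where
    j<N : p * 2 + c < N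
    j<N = ≤-<-trans (+-monoʳ-≤ (p * 2) (s≤s⁻¹ c<2)) (subst (_< N) (double+1 p) (odd<double p<n))

  label-pair : ∀ K u b K′ u′ b′ → suc (blk K u b) + suc (blk K′ u′ b′) ≡ (K + K′) * M + 2 * (u + u′) + (2 + (b + b′))
  label-pair K u b K′ u′ b′ = identity M K u b K′ u′ b′
    where
    identity : ∀ M K u b K′ u′ b′ →
      suc (K * M + (u * 2 + b)) + suc (K′ * M + (u′ * 2 + b′)) ≡ (K + K′) * M + 2 * (u + u′) + (2 + (b + b′))
    identity = solve-∀

  lo+hi : ∀ p → p ≤ l → lo p + hi p ≡ N
  lo+hi p p≤l = begin
    (l ∸ p) + (suc n + p)   ≡⟨ cong ((l ∸ p) +_) (+-comm (suc n) p) ⟩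
    (l ∸ p) + (p + suc n)   ≡⟨ sym (+-assoc (l ∸ p) p (suc n)) ⟩
    (l ∸ p + p) + suc n     ≡⟨ cong (_+ suc n) (m∸n+n≡m p≤l) ⟩
    l + suc n               ≡⟨ identity l ⟩
    N                       ∎
    where
    open ≡-Reasoning
    identity : ∀ l → l + suc (suc l) ≡ 2 * suc l
    identity = solve-∀

  r+t : ∀ t → t < m → r t + t ≡ suc k
  r+t t (s≤s t≤1+k) = m∸n+n≡m t≤1+k

  -- offsets t and r t of the two blocks of a column pair add up to m − 1,
  -- so such a pair of labels sums to E + (b + b′)
  lo+hi-labels : ∀ p t b b′ → p ≤ l → t < m → suc (blk (lo p) t b) + suc (blk (hi p) (r t) b′) ≡ E + (b + b′)
  lo+hi-labels p t b b′ p≤l t<m = begin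
    suc (blk (lo p) t b) + suc (blk (hi p) (r t) b′)     ≡⟨ label-pair (lo p) t b (hi p) (r t) b′ ⟩
    (lo p + hi p) * M + 2 * (t + r t) + (2 + (b + b′))   ≡⟨ cong₂ (λ x y → x * M + 2 * y + (2 + (b + b′))) (lo+hi p p≤l)
                                                                 (trans (+-comm t (r t)) (r+t t t<m)) ⟩
    N * M + 2 * suc k + (2 + (b + b′))                    ≡⟨ identity k l (b + b′) ⟩
    E + (b + b′)                                          ∎
    where
    open ≡-Reasoning
    identity : ∀ k l x → let m = suc (suc k) ; M = 2 * m ; N = 2 * suc l in
      N * M + 2 * suc k + (2 + x) ≡ M + M * N + x
    identity = solve-∀

  row-even : ∀ t → t < m → ∑[ j < N ] L (joinPos (t * 2) j) ≡ V 0 0 t 0 + V 0 1 t 0 + l * E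
  row-even t t<m = trans (row-pairs (t * 2) t 0 (s≤s z≤n) (sym (+-identityʳ _)))
    (cong (V 0 0 t 0 + V 0 1 t 0 +_) (trans (∑-cong l pair) (∑-const l E)))
    where
    pair : ∀ p → p < l → V (suc p) 0 t 0 + V (suc p) 1 t 0 ≡ E
    pair p p<l = trans (+-comm (V (suc p) 0 t 0) (V (suc p) 1 t 0)) (trans (lo+hi-labels (suc p) t 0 0 p<l t<m) (+-identityʳ E))

  row-odd : ∀ t → t < m → ∑[ j < N ] L (joinPos (suc (t * 2)) j) ≡ V 0 0 t 1 + V 0 1 t 1 + l * (E + 2)
  row-odd t t<m = trans (row-pairs (suc (t * 2)) t 1 (s≤s (s≤s z≤n)) (sym (+-comm (t * 2) 1)))
    (cong (V 0 0 t 1 + V 0 1 t 1 +_) (trans (∑-cong l pair) (∑-const l (E + 2))))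
    where
    pair : ∀ p → p < l → V (suc p) 0 t 1 + V (suc p) 1 t 1 ≡ E + 2
    pair p p<l = lo+hi-labels (suc p) t 1 1 p<l t<m

  ∑r : ∑ m r ≡ ∑[ t < m ] t
  ∑r = ∑-reverse m (λ t → t)

  ∑σ : ∑ m σ ≡ ∑[ t < m ] t
  ∑σ = cong (0 +_) (trans (∑-cong (suc k) (λ t t<1+k → +-∸-assoc 1 (s≤s⁻¹ t<1+k))) (∑-reverse (suc k) suc))

  column0 : ∀ (a : ℕ → ℕ) → ∑ m a ≡ ∑[ t < m ] t → ∑[ t < m ] (N * M + 2 * (a t + r t) + 3) ≡ m * (E + 1)
  column0 a ∑a = begin
    ∑[ t < m ] (N * M + 2 * (a t + r t) + 3)                       ≡⟨ ∑-cong m (λ t _ → spread (N * M) (a t) (r t)) ⟩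
    ∑[ t < m ] ((N * M + 3) + (2 * a t + 2 * r t))                 ≡⟨ ∑-+ m (λ _ → N * M + 3) (λ t → 2 * a t + 2 * r t) ⟩
    ∑[ t < m ] (N * M + 3) + ∑[ t < m ] (2 * a t + 2 * r t)        ≡⟨ cong₂ _+_ (∑-const m (N * M + 3)) (∑-+ m (λ t → 2 * a t) (λ t → 2 * r t)) ⟩
    m * (N * M + 3) + (∑[ t < m ] (2 * a t) + ∑[ t < m ] (2 * r t)) ≡⟨ cong (m * (N * M + 3) +_) (cong₂ _+_ (∑-*ˡ m 2 a) (∑-*ˡ m 2 r)) ⟩
    m * (N * M + 3) + (2 * ∑ m a + 2 * ∑ m r)                      ≡⟨ cong (m * (N * M + 3) +_) (cong₂ (λ x y → 2 * x + 2 * y) ∑a ∑r) ⟩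
    m * (N * M + 3) + (2 * ∑[ t < m ] t + 2 * ∑[ t < m ] t)        ≡⟨ cong (λ x → m * (N * M + 3) + (x + x)) (∑-id (suc k)) ⟩
    m * (N * M + 3) + (m * suc k + m * suc k)                      ≡⟨ identity k l ⟩
    m * (E + 1)                                                    ∎
    where
    open ≡-Reasoning
    spread : ∀ x y z → x + 2 * (y + z) + 3 ≡ (x + 3) + (2 * y + 2 * z)
    spread = solve-∀
    identity : ∀ k l → let m = suc (suc k) ; M = 2 * m ; N = 2 * suc l in
      m * (N * M + 3) + (m * suc k + m * suc k) ≡ m * (M + M * N + 1)
    identity = solve-∀

  column : ∀ p c → p < n → c < 2 → ∑[ v < M ] L (joinPos v (p * 2 + c)) ≡ m * (E + 1)
  column p c p<n c<2 = trans (column-pairs p c p<n c<2) (pairs p c p<n c<2)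
    where
    pairs : ∀ p c → p < n → c < 2 → ∑[ t < m ] (V p c t 0 + V p c t 1) ≡ m * (E + 1)
    pairs zero zero _ _ = trans
      (∑-cong m (λ t _ → trans (label-pair (lo 0) (r t) 1 (hi 0) (r t) 0) (cong (λ x → x * M + 2 * (r t + r t) + 3) (lo+hi 0 z≤n))))
      (column0 r ∑r)
    pairs zero (suc zero) _ _ = trans
      (∑-cong m (λ t _ → trans (label-pair (lo 0) (σ t) 0 (hi 0) (r t) 1) (cong (λ x → x * M + 2 * (σ t + r t) + 3) (lo+hi 0 z≤n))))
      (column0 σ ∑σ)
    pairs (suc p) zero (s≤s p<l) _ = trans
      (∑-cong m (λ t t<m → trans (+-comm (V (suc p) 0 t 0) (V (suc p) 0 t 1)) (lo+hi-labels (suc p) t 1 0 p<l t<m)))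
      (∑-const m (E + 1))
    pairs (suc p) (suc zero) (s≤s p<l) _ = trans
      (∑-cong m (λ t t<m → lo+hi-labels (suc p) t 0 1 p<l t<m))
      (∑-const m (E + 1))
    pairs p (suc (suc _)) _ (s≤s (s≤s ()))

  evenSum oddSum indepSum δ : ℕ
  evenSum = 2 * (N * M) + 2 + l * E
  δ  = 2 * M + l
  oddSum = evenSum + 2 * δ
  indepSum = m * (E + 1)

  open JoinVertexSums M' N f L f≡L using (vsum-cycleVertex; vsum-independentVertex)

  odd<M : ∀ t → t < m → suc (t * 2) < M
  odd<M t t<m = ≤-trans (*-monoˡ-≤ 2 t<m) (≤-reflexive (*-comm m 2))

  even<M : ∀ t → t < m → t * 2 < M
  even<M t t<m = ≤-trans (n≤1+n _) (odd<M t t<m)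

  L-cycle : ∀ i → i < M → L i ≡ suc (n * M + i)
  L-cycle i i<M = cong suc (lab-cycle i i<M)

  -- At an even vertex 2t the cycle labels (nM + 2t, nM + 2t − 1) and the
  -- column pair 0 entries (offsets r t, σ t of block lo 0) balance: both
  -- change by 4 when t does.  Vertex 0, with its edge to M − 1, is separate.
  vsum-even : ∀ t → t < m → vsum G f (t * 2) ≡ evenSum
  vsum-even zero t<m = begin
    vsum G f 0                                                                    ≡⟨ vsum-cycleVertex (s≤s z≤n) 0 (s≤s z≤n) ⟩
    L 0 + L M' + ∑[ j < N ] L (joinPos 0 j)                                       ≡⟨ cong₂ _+_ (cong₂ _+_ (L-cycle 0 (s≤s z≤n)) (L-cycle M' ≤-refl)) (row-even 0 t<m) ⟩
    suc (n * M + 0) + suc (n * M + M') + (V 0 0 0 0 + V 0 1 0 0 + l * E)          ≡⟨ cong (λ x → suc (n * M + 0) + suc (n * M + M') + (x + l * E))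
                                                                                         (label-pair (lo 0) (r 0) 1 (lo 0) (σ 0) 0) ⟩
    suc (n * M + 0) + suc (n * M + M') + ((l + l) * M + 2 * (suc k + 0) + 3 + l * E) ≡⟨ identity k l ⟩
    evenSum                                                                       ∎
    where
    open ≡-Reasoning
    identity : ∀ k l → let m = suc (suc k) ; M = 2 * m ; n = suc l ; N = 2 * n ; E = M + M * N in
      suc (n * M + 0) + suc (n * M + (suc k + (suc (suc k) + 0))) + ((l + l) * M + 2 * (suc k + 0) + 3 + l * E)
        ≡ 2 * (N * M) + 2 + l * E
    identity = solve-∀
  vsum-even (suc t) (s≤s (s≤s t≤k)) = begin
    vsum G f (suc t * 2)                                                          ≡⟨ vsum-cycleVertex (s≤s z≤n) (suc t * 2) w<M ⟩
    L (suc t * 2) + L (suc (t * 2)) + ∑[ j < N ] L (joinPos (suc t * 2) j)        ≡⟨ cong₂ _+_ (cong₂ _+_ (L-cycle (suc t * 2) w<M) (L-cycle (suc (t * 2)) (<-trans (n<1+n _) w<M)))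
                                                                                                (row-even (suc t) (s≤s (s≤s t≤k))) ⟩
    cyc + (V 0 0 (suc t) 0 + V 0 1 (suc t) 0 + l * E)                            ≡⟨ cong (λ x → cyc + (x + l * E)) (label-pair (lo 0) (k ∸ t) 1 (lo 0) (suc k ∸ t) 0) ⟩
    cyc + ((l + l) * M + 2 * (k ∸ t + (suc k ∸ t)) + 3 + l * E)                   ≡⟨ cong (λ x → cyc + ((l + l) * M + 2 * (k ∸ t + x) + 3 + l * E)) (+-∸-assoc 1 t≤k) ⟩
    cyc + ((l + l) * M + 2 * (k ∸ t + suc (k ∸ t)) + 3 + l * E)                   ≡⟨ collect k l t (k ∸ t) ⟩
    2 * (n * M) + (l + l) * M + 10 + l * E + 4 * (k ∸ t + t)                      ≡⟨ cong (λ x → 2 * (n * M) + (l + l) * M + 10 + l * E + 4 * x) (m∸n+n≡m t≤k) ⟩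
    2 * (n * M) + (l + l) * M + 10 + l * E + 4 * k                                ≡⟨ identity k l ⟩
    evenSum                                                                       ∎
    where
    open ≡-Reasoning
    cyc = suc (n * M + suc t * 2) + suc (n * M + suc (t * 2))
    w<M : suc t * 2 < M
    w<M = even<M (suc t) (s≤s (s≤s t≤k))
    collect : ∀ k l t d → let m = suc (suc k) ; M = 2 * m ; n = suc l ; N = 2 * n ; E = M + M * N in
      suc (n * M + suc t * 2) + suc (n * M + suc (t * 2)) + ((l + l) * M + 2 * (d + suc d) + 3 + l * E)
        ≡ 2 * (n * M) + (l + l) * M + 10 + l * E + 4 * (d + t)
    collect = solve-∀
    identity : ∀ k l → let m = suc (suc k) ; M = 2 * m ; n = suc l ; N = 2 * n ; E = M + M * N in
      2 * (n * M) + (l + l) * M + 10 + l * E + 4 * k ≡ 2 * (N * M) + 2 + l * E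
    identity = solve-∀

  -- at an odd vertex 2t + 1 the cycle labels grow with t and the offsets r t
  -- of block hi 0 shrink with t
  vsum-odd : ∀ t → t < m → vsum G f (suc (t * 2)) ≡ oddSum
  vsum-odd t t<m = begin
    vsum G f (suc (t * 2))                                                        ≡⟨ vsum-cycleVertex (s≤s z≤n) (suc (t * 2)) (odd<M t t<m) ⟩
    L (suc (t * 2)) + L (t * 2) + ∑[ j < N ] L (joinPos (suc (t * 2)) j)          ≡⟨ cong₂ _+_ (cong₂ _+_ (L-cycle (suc (t * 2)) (odd<M t t<m)) (L-cycle (t * 2) (even<M t t<m)))
                                                                                                (row-odd t t<m) ⟩
    cyc + (V 0 0 t 1 + V 0 1 t 1 + l * (E + 2))                                  ≡⟨ cong (λ x → cyc + (x + l * (E + 2))) (label-pair (hi 0) (r t) 0 (hi 0) (r t) 1) ⟩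
    cyc + ((hi 0 + hi 0) * M + 2 * (r t + r t) + 3 + l * (E + 2))                 ≡⟨ collect k l t (r t) ⟩
    2 * (n * M) + (hi 0 + hi 0) * M + 6 + l * (E + 2) + 4 * (r t + t)             ≡⟨ cong (λ x → 2 * (n * M) + (hi 0 + hi 0) * M + 6 + l * (E + 2) + 4 * x) (r+t t t<m) ⟩
    2 * (n * M) + (hi 0 + hi 0) * M + 6 + l * (E + 2) + 4 * suc k                 ≡⟨ identity k l ⟩
    oddSum                                                                        ∎
    where
    open ≡-Reasoning
    cyc = suc (n * M + suc (t * 2)) + suc (n * M + t * 2)
    collect : ∀ k l t a → let m = suc (suc k) ; M = 2 * m ; n = suc l ; N = 2 * n ; E = M + M * N in
      suc (n * M + suc (t * 2)) + suc (n * M + t * 2) + ((suc n + 0 + (suc n + 0)) * M + 2 * (a + a) + 3 + l * (E + 2))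
        ≡ 2 * (n * M) + (suc n + 0 + (suc n + 0)) * M + 6 + l * (E + 2) + 4 * (a + t)
    collect = solve-∀
    identity : ∀ k l → let m = suc (suc k) ; M = 2 * m ; n = suc l ; N = 2 * n ; E = M + M * N in
      2 * (n * M) + (suc n + 0 + (suc n + 0)) * M + 6 + l * (E + 2) + 4 * suc k ≡ 2 * (N * M) + 2 + l * E + 2 * (2 * M + l)
    identity = solve-∀

  vsum-independent : ∀ j → j < N → vsum G f (M + j) ≡ indepSum
  vsum-independent j j<N = begin
    vsum G f (M + j)                               ≡⟨ vsum-independentVertex j j<N ⟩
    ∑[ v < M ] L (joinPos v j)                     ≡⟨ ∑-cong M (λ v _ → cong (L ∘ joinPos v) (sym (divMod-recompose j 2))) ⟩
    ∑[ v < M ] L (joinPos v (j / 2 * 2 + j % 2))   ≡⟨ column (j / 2) (j % 2) (half< j<N) (m%n<n j 2) ⟩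
    indepSum                                       ∎
    where open ≡-Reasoning

  -- The three values are distinct: with Ω = (n + 1)(E + 1) we have
  -- evenSum = Ω − δ and oddSum = Ω + δ with 0 < δ < E + 1, while
  -- indepSum = m (E + 1) is a multiple of E + 1.

  evenSum+δ : evenSum + δ ≡ suc n * (E + 1)
  evenSum+δ = identity k l
    where
    identity : ∀ k l → let m = suc (suc k) ; M = 2 * m ; n = suc l ; N = 2 * n ; E = M + M * N in
      2 * (N * M) + 2 + l * E + (2 * M + l) ≡ suc n * (E + 1)
    identity = solve-∀

  oddSum≡ : oddSum ≡ suc n * (E + 1) + δ
  oddSum≡ = trans (twice evenSum δ) (cong (_+ δ) evenSum+δ)
    where
    twice : ∀ a d → a + 2 * d ≡ a + d + d
    twice = solve-∀

  δ<E+1 : δ < E + 1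
  δ<E+1 = subst (δ <_) (sym (identity k l)) (m<m+n δ (s≤s z≤n))
    where
    identity : ∀ k l → let m = suc (suc k) ; M = 2 * m ; n = suc l ; N = 2 * n ; E = M + M * N in
      E + 1 ≡ (2 * M + l) + suc (M + l * (4 * k + 7))
    identity = solve-∀

  0<δ : 0 < δ
  0<δ = s≤s z≤n

  evenSum≢oddSum : evenSum ≢ oddSum
  evenSum≢oddSum = <⇒≢ (m<m+n evenSum (*-monoʳ-< 2 0<δ))

  evenSum≢indepSum : evenSum ≢ indepSum
  evenSum≢indepSum eq = not-multiple m (suc n) δ (E + 1) 0<δ δ<E+1 (trans (cong (_+ δ) (sym eq)) evenSum+δ)

  oddSum≢indepSum : oddSum ≢ indepSum
  oddSum≢indepSum eq = not-multiple (suc n) m δ (E + 1) 0<δ δ<E+1 (trans (sym oddSum≡) eq)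

  parity : ∀ w → (∃ λ t → w ≡ t * 2) ⊎ (∃ λ t → w ≡ suc (t * 2))
  parity zero = inj₁ (0 , refl)
  parity (suc w) with parity w
  ... | inj₁ (t , refl) = inj₂ (t , refl)
  ... | inj₂ (t , refl) = inj₁ (suc t , refl)

  half-bound : ∀ t → t * 2 < M → t < m
  half-bound t t*2<M = *-cancelʳ-< 2 t m (subst (t * 2 <_) (*-comm 2 m) t*2<M)

  vsum-cycle : ∀ w → w < M → vsum G f w ≡ evenSum ⊎ vsum G f w ≡ oddSum
  vsum-cycle w w<M with parity w
  ... | inj₁ (t , refl) = inj₁ (vsum-even t (half-bound t w<M))
  ... | inj₂ (t , refl) = inj₂ (vsum-odd t (half-bound t (<-trans (n<1+n _) w<M)))

  -- Adjacent vertices receive different sums: consecutive cycle vertices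
  -- have opposite parity, and spokes join a cycle vertex to an independent one.
  cycle-neighbours : ∀ i → suc i < M → vsum G f i ≢ vsum G f (suc i)
  cycle-neighbours i 1+i<M with parity i
  ... | inj₁ (t , refl) = λ eq → evenSum≢oddSum (trans (sym (vsum-even t t<m)) (trans eq (vsum-odd t t<m)))
    where t<m = half-bound t (<-trans (n<1+n _) 1+i<M)
  ... | inj₂ (t , refl) = λ eq → evenSum≢oddSum (trans (sym (vsum-even (suc t) 1+t<m)) (trans (sym eq) (vsum-odd t (half-bound t (<-trans (n<1+n _) (<-trans (n<1+n _) 1+i<M))))))
    where 1+t<m = half-bound (suc t) 1+i<M

  M'-odd : M' ≡ suc (suc k * 2)
  M'-odd = identity k
    where
    identity : ∀ k → suc k + (suc (suc k) + 0) ≡ suc (suc k * 2)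
    identity = solve-∀

  antimagic : ∀ e → vsum G f (proj₁ (endpoints G e)) ≢ vsum G f (proj₂ (endpoints G e))
  antimagic e = separated (classifyEdge M' N (∈-lookup e))
    where
    separated : ∀ {x} → JoinEdge M' N x → vsum G f (proj₁ x) ≢ vsum G f (proj₂ x)
    separated (path i 1+i<M) = cycle-neighbours i 1+i<M
    separated closing eq = evenSum≢oddSum (trans (sym (vsum-even 0 (s≤s z≤n))) (trans (sym eq) (trans (cong (vsum G f) M'-odd) (vsum-odd (suc k) ≤-refl))))
    separated (spoke v j v<M j<N) eq with vsum-cycle v v<M
    ... | inj₁ ≡evenSum = evenSum≢indepSum (trans (sym ≡evenSum) (trans eq (vsum-independent j j<N)))
    ... | inj₂ ≡oddSum = oddSum≢indepSum (trans (sym ≡oddSum) (trans eq (vsum-independent j j<N)))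

  colors≤3 : colorNumber G f ≤ 3
  colors≤3 = distinctValues≤3 (map (vsum G f) (upTo (M + N))) (AllP.map⁺ (AllP.applyUpTo⁺₁ (λ u → u) (M + N) value))
    where
    value : ∀ {u} → u < M + N → vsum G f u ∈ evenSum ∷ oddSum ∷ indepSum ∷ []
    value {u} u<M+N with u <? M
    ... | yes u<M with vsum-cycle u u<M
    ...   | inj₁ ≡evenSum = here ≡evenSum
    ...   | inj₂ ≡oddSum = there (here ≡oddSum)
    value {u} u<M+N | no u≮M = there (there (here (trans (cong (vsum G f) (sym M+j≡u)) (vsum-independent (u ∸ M) j<N))))
      where
      M+j≡u : M + (u ∸ M) ≡ u
      M+j≡u = m+[n∸m]≡n (≮⇒≥ u≮M)
      j<N : u ∸ M < N
      j<N = +-cancelˡ-< M (u ∸ M) N (subst (_< M + N) (sym M+j≡u) u<M+N)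

mainTheorem2 : (m n : ℕ) → 2 ≤ m → 1 ≤ n → ChiLaEq (cycleJoinEmpty (2 * m) (2 * n)) 3
mainTheorem2 (suc (suc k)) (suc l) (s≤s (s≤s z≤n)) (s≤s z≤n) =
  (f , isLocalAntimagic , ≤-antisym colors≤3 (join-colors≥3 M' N (s≤s z≤n) (s≤s z≤n) f isLocalAntimagic))
  , join-colors≥3 M' N (s≤s z≤n) (s≤s z≤n)
  where
  open Construction k l
  isLocalAntimagic : IsLocalAntimagic G f
  isLocalAntimagic = injective⇒bijective f f-injective , antimagic
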